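{- Let $s$ be a positive integer and let $\lambda$ be a partition whose remainder sequence $(\rho_1,\dots,\rho_m)$ modulo $s$ is strictly increasing, with row position sequence $(\gamma_1,\dots,\gamma_m)$. Let $\nu^+$ be the set of cells consisting of the Ferrers diagram of $\lambda\!\downarrow_s=(\lfloor\lambda_1/s\rfloor,\dots,\lfloor\lambda_\ell/s\rfloor)$ together with the $m$ green cells $(\gamma_j,\lceil\lambda_{\gamma_j}/s\rceil)$, $j=1,\dots,m$. Then $r_s(\lambda)$ equals the number of rows of $\nu^+$ minus $m$, and $c_s(\lambda)$ equals the number of columns of $\nu^+$ minus $m$.
   Context: Partitions are identified with Ferrers diagrams; cell $(i,j)$ is in row $i$, column $j$. The number of rows (columns) of a set of cells means the number of distinct row (column) indices occurring among its cells. For a cell $z$, $\mathrm{leg}(z)$ is the number of cells strictly below $z$ in its column and $\mathrm{arm}(z)$ the number of cells strictly to its right in its row. $r_s(\lambda)$ is the number of parts of $\lambda$ divisible by $s$; $c_s(\lambda)$ is the number of cells $z$ of $\lambda$ with $\mathrm{leg}(z)=0$ and $s\mid\mathrm{arm}(z)+1$. The row position sequence is the increasing sequence $\gamma_1<\dots<\gamma_m$ of indices $i$ with $s\nmid\lambda_i$, and the remainder sequence is $\rho_j=\lambda_{\gamma_j}\bmod s$. -}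

module Defs where

open import Data.Nat using (ℕ; zero; suc; _+_; _∸_; _≤_; _<_; _>_; NonZero)
open import Data.Nat.Properties using (_≟_; _≤?_; _<?_)
open import Data.Nat.DivMod using (_/_; _%_)
open import Data.Nat.Divisibility using (_∣_; _∣?_)
open import Data.List using (List; []; _∷_; length; map; filter; zip; upTo; concatMap; deduplicate)
open import Data.List.Relation.Unary.All using (All)
open import Data.List.Relation.Unary.Linked using (Linked)
open import Data.Product using (_×_; _,_; proj₁; proj₂)
open import Relation.Nullary using (¬?)
open import Relation.Nullary.Decidable using (_×-dec_)
open import Relation.Binary.PropositionalEquality using (_≡_)

IsPartition : List ℕ → Set
IsPartition la = Linked (λ a b → b ≤ a) la × All (λ a → 0 < a) la

indexed : List ℕ → List (ℕ × ℕ)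
indexed la = zip (map suc (upTo (length la))) la

-- A cell is (row , column), both 1-based.
Cell : Set
Cell = ℕ × ℕ

diagram : List ℕ → List Cell
diagram la = concatMap (λ p → map (λ j → (proj₁ p , suc j)) (upTo (proj₂ p))) (indexed la)

leg : List ℕ → Cell → ℕ
leg la z = length (filter (λ c → (proj₁ z <? proj₁ c) ×-dec (proj₂ c ≟ proj₂ z)) (diagram la))

arm : List ℕ → Cell → ℕ
arm la z = length (filter (λ c → (proj₁ c ≟ proj₁ z) ×-dec (proj₂ z <? proj₂ c)) (diagram la))

r : ℕ → List ℕ → ℕ
r s la = length (filter (λ a → s ∣? a) la)

c : ℕ → List ℕ → ℕ
c s la = length (filter (λ z → (leg la z ≟ 0) ×-dec (s ∣? suc (arm la z))) (diagram la))

nondivRows : ℕ → List ℕ → List (ℕ × ℕ)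
nondivRows s la = filter (λ p → ¬? (s ∣? proj₂ p)) (indexed la)

rowPositions : ℕ → List ℕ → List ℕ
rowPositions s la = map proj₁ (nondivRows s la)

remainders : (s : ℕ) → {{NonZero s}} → List ℕ → List ℕ
remainders s la = map (λ p → proj₂ p % s) (nondivRows s la)

ceilDiv : ℕ → (s : ℕ) → {{NonZero s}} → ℕ
ceilDiv a s = (a + (s ∸ 1)) / s

downS : (s : ℕ) → {{NonZero s}} → List ℕ → List ℕ
downS s la = map (λ a → a / s) la

greenCells : (s : ℕ) → {{NonZero s}} → List ℕ → List Cell
greenCells s la = map (λ p → (proj₁ p , ceilDiv (proj₂ p) s)) (nondivRows s la)

nuPlus : (s : ℕ) → {{NonZero s}} → List ℕ → List Cell
nuPlus s la = diagram (downS s la) Data.List.++ greenCells s la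

numRows : List Cell → ℕ
numRows cs = length (deduplicate _≟_ (map proj₁ cs))

numCols : List Cell → ℕ
numCols cs = length (deduplicate _≟_ (map proj₂ cs))

module Submission where

open import Defs
open import Data.Nat
  using (ℕ; zero; suc; _+_; _*_; _∸_; _≤_; _<_; _≥_; _≤?_; _<?_; z≤n; s≤s; s≤s⁻¹; pred; NonZero; >-nonZero)
open import Data.Nat.Properties
open import Data.Nat.DivMod
open import Data.Nat.Divisibility using (_∣_; _∣?_; divides; divides-refl; n∣m⇒m%n≡0; m%n≡0⇒n∣m; ∣⇒≤; _∣0)
open import Data.Nat.Solver using (module +-*-Solver)
open import Data.List using (List; []; _∷_; _++_; length; map; filter; zip; upTo; applyUpTo; concatMap; deduplicate)
open import Data.List.Properties
  using ( length-++; filter-++; filter-all; filter-none; filter-≐; filter-accept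
        ; length-map; length-applyUpTo; length-upTo; map-upTo; map-∘)
open import Data.List.Membership.Propositional using (_∈_; find; lose)
open import Data.List.Membership.Propositional.Properties
open import Data.List.Membership.Propositional.Properties.WithK using (unique∧set⇒bag)
open import Data.List.Relation.Unary.All as All using (All; []; _∷_)
open import Data.List.Relation.Unary.Any using (here; there)
open import Data.List.Relation.Unary.Linked as Linked using (Linked; []; [-]; _∷_)
import Data.List.Relation.Unary.Linked.Properties as Linked
open import Data.List.Relation.Unary.Unique.Propositional.Properties using (applyUpTo⁺₁)
open import Data.List.Relation.Unary.Unique.DecPropositional.Properties _≟_ using (deduplicate-!)
open import Data.List.Relation.Binary.BagAndSetEquality using (∼bag⇒↭)
open import Data.List.Relation.Binary.Permutation.Propositional.Properties using (↭-length)
open import Data.Product using (_×_; _,_; proj₁; proj₂; map₁; map₂; ∃-syntax; ∃₂)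
open import Data.Sum using (_⊎_; inj₁; inj₂)
open import Data.Empty using (⊥-elim)
open import Function using (id; _∘_; case_of_; _⇔_; mk⇔; Equivalence)
open import Function.Properties.Equivalence using () renaming (sym to ⇔-sym; trans to ⇔-trans)
open import Relation.Nullary using (¬_; Dec; yes; no; ¬?; contradiction)
open import Relation.Nullary.Decidable using (_×-dec_)
open import Relation.Unary using (Pred; Decidable)
open import Relation.Binary.PropositionalEquality
open ≡-Reasoning

-- Every row i of λ meets ν⁺: in column 1 of λ↓s if s ∣ λ_i (then λ_i ≥ s), in its green
-- cell otherwise; so ν⁺ has ℓ(λ) = r_s(λ) + m rows. Its columns are exactly 1, …, ⌈λ₁/s⌉.
-- The cells of row i with leg 0 are the columns λ_{i+1} < j ≤ λ_i, whose values arm + 1 run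
-- through 1, …, λ_i − λ_{i+1}; hence c_s(λ) = Σ_i ⌊(λ_i − λ_{i+1})/s⌋. Finally
-- ⌊(a − b)/s⌋ + ⌈b/s⌉ = ⌊a/s⌋ holds for b ≤ a exactly when b mod s = 0 or a mod s < b mod s,
-- which the increasing remainder sequence guarantees for consecutive rows. Adding [s ∤ λ_i] to
-- the i-th summand therefore makes the sum telescope to ⌈λ₁/s⌉, i.e. c_s(λ) + m = ⌈λ₁/s⌉.

pred[n]<n : ∀ n .{{_ : NonZero n}} → pred n < n
pred[n]<n n = ≤-reflexive (suc-pred n)

[m+kn]/n≡k : ∀ {m} k n .{{_ : NonZero n}} → m < n → (m + k * n) / n ≡ k
[m+kn]/n≡k {m} k n m<n = begin
  (m + k * n) / n   ≡⟨ +-distrib-/-∣ʳ m (divides-refl k) ⟩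
  m / n + k * n / n ≡⟨ cong₂ _+_ (m<n⇒m/n≡0 m<n) (m*n/n≡m k n) ⟩
  k                 ∎

suc[m%n]≡n⇒1+m≡[1+m/n]*n : ∀ m n .{{_ : NonZero n}} → suc (m % n) ≡ n → suc m ≡ suc (m / n) * n
suc[m%n]≡n⇒1+m≡[1+m/n]*n m n full = begin
  suc m                   ≡⟨ cong suc (m≡m%n+[m/n]*n m n) ⟩
  suc (m % n) + m / n * n ≡⟨ cong (_+ m / n * n) full ⟩
  suc (m / n) * n         ∎

[1+m]/n≡1+m/n : ∀ m n .{{_ : NonZero n}} → n ∣ suc m → suc m / n ≡ suc (m / n)
[1+m]/n≡1+m/n m n n∣1+m =
  trans (/-congˡ (suc[m%n]≡n⇒1+m≡[1+m/n]*n m n full)) (m*n/n≡m (suc (m / n)) n)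
  where
  full : suc (m % n) ≡ n
  full = trans (cong suc (%-pred-≡0 (n∣m⇒m%n≡0 (suc m) n n∣1+m))) (suc-pred n)

[1+m]/n≡m/n : ∀ m n .{{_ : NonZero n}} → ¬ n ∣ suc m → suc m / n ≡ m / n
[1+m]/n≡m/n m n n∤1+m = begin
  suc m / n                     ≡⟨ /-congˡ (cong suc (m≡m%n+[m/n]*n m n)) ⟩
  (suc (m % n) + m / n * n) / n ≡⟨ [m+kn]/n≡k (m / n) n (≤∧≢⇒< (m%n<n m n) not-full) ⟩
  m / n                         ∎
  where
  not-full : suc (m % n) ≢ n
  not-full full = n∤1+m (divides (suc (m / n)) (suc[m%n]≡n⇒1+m≡[1+m/n]*n m n full))

+-distrib-/-carry : ∀ m n {d} .{{_ : NonZero d}} → d ≤ m % d + n % d →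
                    (m + n) / d ≡ suc (m / d + n / d)
+-distrib-/-carry m n {d} carry = trans (/-congˡ m+n≡t+[1+q]*d) ([m+kn]/n≡k (suc q) d t<d)
  where
  open +-*-Solver
  q = m / d + n / d
  t = m % d + n % d ∸ d
  t<d : t < d
  t<d = m<n+o⇒m∸n<o (m % d + n % d) d (+-mono-< (m%n<n m d) (m%n<n n d))
  m+n≡t+[1+q]*d : m + n ≡ t + suc q * d
  m+n≡t+[1+q]*d = begin
    m + n                                     ≡⟨ cong₂ _+_ (m≡m%n+[m/n]*n m d) (m≡m%n+[m/n]*n n d) ⟩
    (m % d + m / d * d) + (n % d + n / d * d) ≡⟨ solve 5 (λ a b p q e → (a :+ p :* e) :+ (b :+ q :* e)
                                                   := (a :+ b) :+ (p :+ q) :* e) refl (m % d) (n % d) (m / d) (n / d) d ⟩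
    (m % d + n % d) + q * d                   ≡⟨ cong (_+ q * d) (m+[n∸m]≡n carry) ⟨
    (d + t) + q * d                           ≡⟨ solve 3 (λ e u q → (e :+ u) :+ q :* e := u :+ (con 1 :+ q) :* e) refl d t q ⟩
    t + suc q * d                             ∎

n%d≤[m+n]%d : ∀ m n {d} .{{_ : NonZero d}} → m % d + n % d < d → n % d ≤ (m + n) % d
n%d≤[m+n]%d m n {d} no-carry = subst (n % d ≤_) m%d+n%d≡[m+n]%d (m≤n+m (n % d) (m % d))
  where
  m%d+n%d≡[m+n]%d : m % d + n % d ≡ (m + n) % d
  m%d+n%d≡[m+n]%d = trans (sym (m<n⇒m%n≡m no-carry)) (sym (%-distribˡ-+ m n d))

ceilDiv-∣ : ∀ {a} s {{_ : NonZero s}} → s ∣ a → ceilDiv a s ≡ a / s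
ceilDiv-∣ {a} s s∣a = begin
  (a + pred s) / s   ≡⟨ +-distrib-/-∣ˡ (pred s) s∣a ⟩
  a / s + pred s / s ≡⟨ cong (a / s +_) (m<n⇒m/n≡0 (pred[n]<n s)) ⟩
  a / s + 0          ≡⟨ +-identityʳ (a / s) ⟩
  a / s              ∎

ceilDiv-∤ : ∀ {a} s {{_ : NonZero s}} → ¬ s ∣ a → ceilDiv a s ≡ suc (a / s)
ceilDiv-∤ {a} s s∤a = begin
  (a + pred s) / s         ≡⟨ +-distrib-/-carry a (pred s) carry ⟩
  suc (a / s + pred s / s) ≡⟨ cong (λ x → suc (a / s + x)) (m<n⇒m/n≡0 (pred[n]<n s)) ⟩
  suc (a / s + 0)          ≡⟨ cong suc (+-identityʳ (a / s)) ⟩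
  suc (a / s)              ∎
  where
  carry : s ≤ a % s + pred s % s
  carry = subst₂ _≤_ (suc-pred s) (cong (a % s +_) (sym (m<n⇒m%n≡m (pred[n]<n s))))
                 (+-monoˡ-≤ (pred s) (n≢0⇒n>0 (s∤a ∘ m%n≡0⇒n∣m a s)))

/≤ceilDiv : ∀ a s {{_ : NonZero s}} → a / s ≤ ceilDiv a s
/≤ceilDiv a s = /-monoˡ-≤ s (m≤m+n a (pred s))

ceilDiv-mono-≤ : ∀ {a b} s {{_ : NonZero s}} → a ≤ b → ceilDiv a s ≤ ceilDiv b s
ceilDiv-mono-≤ s a≤b = /-monoˡ-≤ s (+-monoˡ-≤ (pred s) a≤b)

ceilDiv-pos : ∀ {a} s {{_ : NonZero s}} → 0 < a → 0 < ceilDiv a s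
ceilDiv-pos {a} s a>0 = m≥n⇒m/n>0 (subst (_≤ a + pred s) (suc-pred s) (+-monoˡ-≤ (pred s) a>0))

[a∸b]/s+⌈b/s⌉≡a/s : ∀ {a b} s {{_ : NonZero s}} → b ≤ a → s ∣ b ⊎ a % s < b % s →
                     (a ∸ b) / s + ceilDiv b s ≡ a / s
[a∸b]/s+⌈b/s⌉≡a/s {a} {b} s b≤a (inj₁ s∣b) = begin
  (a ∸ b) / s + ceilDiv b s ≡⟨ cong ((a ∸ b) / s +_) (ceilDiv-∣ s s∣b) ⟩
  (a ∸ b) / s + b / s       ≡⟨ +-distrib-/-∣ʳ (a ∸ b) s∣b ⟨
  (a ∸ b + b) / s           ≡⟨ /-congˡ (m∸n+n≡m b≤a) ⟩
  a / s                     ∎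
[a∸b]/s+⌈b/s⌉≡a/s {a} {b} s b≤a (inj₂ a%s<b%s) = begin
  (a ∸ b) / s + ceilDiv b s ≡⟨ cong ((a ∸ b) / s +_) (ceilDiv-∤ s s∤b) ⟩
  (a ∸ b) / s + suc (b / s) ≡⟨ +-suc ((a ∸ b) / s) (b / s) ⟩
  suc ((a ∸ b) / s + b / s) ≡⟨ +-distrib-/-carry (a ∸ b) b carry ⟨
  (a ∸ b + b) / s           ≡⟨ /-congˡ (m∸n+n≡m b≤a) ⟩
  a / s                     ∎
  where
  s∤b : ¬ s ∣ b
  s∤b s∣b = n≮0 (subst (a % s <_) (n∣m⇒m%n≡0 b s s∣b) a%s<b%s)
  carry : s ≤ (a ∸ b) % s + b % s
  carry = ≮⇒≥ λ no-carry → <⇒≱ a%s<b%s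
    (subst (λ x → b % s ≤ x % s) (m∸n+n≡m b≤a) (n%d≤[m+n]%d (a ∸ b) b no-carry))

module _ {a p q} {A : Set a} {P : Pred A p} {Q : Pred A q} (P? : Decidable P) (Q? : Decidable Q) where

  filter-cong-All : ∀ {xs} → All (λ x → P x ⇔ Q x) xs → filter P? xs ≡ filter Q? xs
  filter-cong-All {[]}     []           = refl
  filter-cong-All {x ∷ xs} (P⇔Q ∷ P⇔Qs) with P? x | Q? x
  ... | yes _  | yes _  = cong (x ∷_) (filter-cong-All P⇔Qs)
  ... | yes px | no ¬qx = ⊥-elim (¬qx (Equivalence.to P⇔Q px))
  ... | no ¬px | yes qx = ⊥-elim (¬px (Equivalence.from P⇔Q qx))
  ... | no _   | no _   = filter-cong-All P⇔Qs

module _ {a p} {A : Set a} {P : Pred A p} (P? : Decidable P) where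

  length-filter-++ : ∀ xs ys → length (filter P? (xs ++ ys)) ≡ length (filter P? xs) + length (filter P? ys)
  length-filter-++ xs ys = trans (cong length (filter-++ P? xs ys)) (length-++ (filter P? xs))

  length-filter-map : ∀ {b} {B : Set b} (f : B → A) xs → length (filter P? (map f xs)) ≡ length (filter (P? ∘ f) xs)
  length-filter-map f []       = refl
  length-filter-map f (x ∷ xs) with P? (f x)
  ... | yes _ = cong suc (length-filter-map f xs)
  ... | no _  = length-filter-map f xs

  length-filter-+-∁ : ∀ xs → length (filter P? xs) + length (filter (λ x → ¬? (P? x)) xs) ≡ length xs
  length-filter-+-∁ []       = refl
  length-filter-+-∁ (x ∷ xs) with P? x
  ... | yes _ = cong suc (length-filter-+-∁ xs)
  ... | no _  = trans (+-suc _ _) (cong suc (length-filter-+-∁ xs))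

  length-filter-pos : ∀ {x xs} → x ∈ xs → P x → 0 < length (filter P? xs)
  length-filter-pos {xs = xs} x∈xs px with filter P? xs | ∈-filter⁺ P? x∈xs px
  ... | _ ∷ _ | _ = s≤s z≤n

  linked-filter-tail : ∀ {r} {R : A → A → Set r} {x xs} → Linked R (filter P? (x ∷ xs)) → Linked R (filter P? xs)
  linked-filter-tail {x = x} with P? x
  ... | yes _ = Linked.tail
  ... | no _  = id

length-filter-applyUpTo-suc : ∀ {p} {P : Pred ℕ p} (P? : Decidable P) n →
                              length (filter P? (applyUpTo suc n)) ≡ length (filter (P? ∘ suc) (upTo n))
length-filter-applyUpTo-suc P? n =
  trans (cong (length ∘ filter P?) (sym (map-upTo suc n))) (length-filter-map P? suc (upTo n))

∈-applyUpTo-suc⇔ : ∀ {x} n → x ∈ applyUpTo suc n ⇔ (1 ≤ x × x ≤ n)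
∈-applyUpTo-suc⇔ {x} n = mk⇔ to from
  where
  to : x ∈ applyUpTo suc n → 1 ≤ x × x ≤ n
  to x∈ with ∈-applyUpTo⁻ suc x∈
  ... | _ , i<n , refl = s≤s z≤n , i<n
  from : 1 ≤ x × x ≤ n → x ∈ applyUpTo suc n
  from (s≤s z≤n , x≤n) = ∈-applyUpTo⁺ suc x≤n

length-deduplicate-interval : ∀ {xs} n → (∀ {x} → x ∈ xs ⇔ (1 ≤ x × x ≤ n)) →
                              length (deduplicate _≟_ xs) ≡ n
length-deduplicate-interval {xs} n xs⇔[1,n] =
  trans (↭-length (∼bag⇒↭ (unique∧set⇒bag (deduplicate-! xs) [1,n]-unique dedup⇔[1,n])))
        (length-applyUpTo suc n)
  where
  [1,n]-unique = applyUpTo⁺₁ suc n (λ i<j _ → <⇒≢ (s≤s i<j))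
  dedup⇔[1,n] : ∀ {x} → x ∈ deduplicate _≟_ xs ⇔ x ∈ applyUpTo suc n
  dedup⇔[1,n] = ⇔-trans (⇔-sym (deduplicate-∈⇔ _≟_)) (⇔-trans xs⇔[1,n] (⇔-sym (∈-applyUpTo-suc⇔ n)))

count-< : ∀ j a → length (filter (j <?_) (upTo a)) ≡ a ∸ suc j
count-< j       zero    = refl
count-< zero    (suc a) = begin
  length (filter (0 <?_) (applyUpTo suc a))   ≡⟨ length-filter-applyUpTo-suc (0 <?_) a ⟩
  length (filter (λ t → 0 <? suc t) (upTo a))
    ≡⟨ cong length (filter-all (λ t → 0 <? suc t) {upTo a} (All.tabulate λ _ → s≤s z≤n)) ⟩
  length (upTo a)                             ≡⟨ length-upTo a ⟩
  a                                           ∎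
count-< (suc j) (suc a) = begin
  length (filter (suc j <?_) (applyUpTo suc a))   ≡⟨ length-filter-applyUpTo-suc (suc j <?_) a ⟩
  length (filter (λ t → suc j <? suc t) (upTo a))
    ≡⟨ cong length (filter-≐ (λ t → suc j <? suc t) (j <?_) (s≤s⁻¹ , s≤s) (upTo a)) ⟩
  length (filter (j <?_) (upTo a))                ≡⟨ count-< j a ⟩
  a ∸ suc j                                       ∎

module _ (s : ℕ) .{{_ : NonZero s}} where

  count-multiples : ∀ d → length (filter (λ t → s ∣? (d ∸ t)) (upTo d)) ≡ d / s
  count-multiples zero = sym (0/n≡0 s)
  count-multiples (suc d)
    with tail ← trans (length-filter-applyUpTo-suc (λ t → s ∣? (suc d ∸ t)) d) (count-multiples d)
       | s ∣? suc d
  ... | yes s∣1+d = trans (cong suc tail) (sym ([1+m]/n≡1+m/n d s s∣1+d))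
  ... | no s∤1+d  = trans tail (sym ([1+m]/n≡m/n d s s∤1+d))

  count-gap-multiples : ∀ b a → length (filter (λ j → (b ≤? j) ×-dec (s ∣? (a ∸ j))) (upTo a)) ≡ (a ∸ b) / s
  count-gap-multiples b       zero    = sym (trans (/-congˡ (0∸n≡0 b)) (0/n≡0 s))
  count-gap-multiples zero    (suc a) = trans
    (cong length (filter-≐ (λ j → (0 ≤? j) ×-dec (s ∣? (suc a ∸ j))) (λ j → s ∣? (suc a ∸ j))
                           (proj₂ , (z≤n ,_)) (upTo (suc a))))
    (count-multiples (suc a))
  count-gap-multiples (suc b) (suc a) = begin
    length (filter R? (applyUpTo suc a)) ≡⟨ length-filter-applyUpTo-suc R? a ⟩
    length (filter (R? ∘ suc) (upTo a))  ≡⟨ cong length (filter-≐ (R? ∘ suc) R′? (map₁ s≤s⁻¹ , map₁ s≤s) (upTo a)) ⟩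
    length (filter R′? (upTo a))         ≡⟨ count-gap-multiples b a ⟩
    (a ∸ b) / s                          ∎
    where
    R?  = λ j → (suc b ≤? j) ×-dec (s ∣? (suc a ∸ j))
    R′? = λ j → (b ≤? j) ×-dec (s ∣? (a ∸ j))

-- Numbering the rows from k makes diagramFrom k (a ∷ la) unfold to
-- rowCells (k , a) ++ diagramFrom (suc k) la.
indexedFrom : ℕ → List ℕ → List (ℕ × ℕ)
indexedFrom k []       = []
indexedFrom k (a ∷ la) = (k , a) ∷ indexedFrom (suc k) la

rowCells : ℕ × ℕ → List Cell
rowCells p = map (λ j → (proj₁ p , suc j)) (upTo (proj₂ p))

diagramFrom : ℕ → List ℕ → List Cell
diagramFrom k la = concatMap rowCells (indexedFrom k la)

zip-applyUpTo : ∀ f k la → (∀ i → f i ≡ k + i) → zip (applyUpTo f (length la)) la ≡ indexedFrom k la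
zip-applyUpTo f k []       f≗k+ = refl
zip-applyUpTo f k (a ∷ la) f≗k+ = cong₂ _∷_
  (cong (_, a) (trans (f≗k+ 0) (+-identityʳ k)))
  (zip-applyUpTo (f ∘ suc) (suc k) la (λ i → trans (f≗k+ (suc i)) (+-suc k i)))

indexed≡indexedFrom : ∀ la → indexed la ≡ indexedFrom 1 la
indexed≡indexedFrom la =
  trans (cong (λ is → zip is la) (map-upTo suc (length la))) (zip-applyUpTo suc 1 la (λ _ → refl))

diagram≡diagramFrom : ∀ la → diagram la ≡ diagramFrom 1 la
diagram≡diagramFrom la = cong (concatMap rowCells) (indexed≡indexedFrom la)

∈-indexedFrom⁻ : ∀ {i a} k la → (i , a) ∈ indexedFrom k la → k ≤ i × i < k + length la × a ∈ la
∈-indexedFrom⁻ k (a ∷ la) (here refl) = ≤-refl , m<m+n k (s≤s z≤n) , here refl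
∈-indexedFrom⁻ {i} k (b ∷ la) (there p∈) with ∈-indexedFrom⁻ (suc k) la p∈
... | k<i , i<1+k+ℓ , a∈la = <⇒≤ k<i , subst (i <_) (sym (+-suc k (length la))) i<1+k+ℓ , there a∈la

∈-indexedFrom⁺ : ∀ {i} k la → k ≤ i → i < k + length la → ∃[ a ] (i , a) ∈ indexedFrom k la
∈-indexedFrom⁺ {i} k []       k≤i i<k+0 = contradiction (subst (i <_) (+-identityʳ k) i<k+0) (≤⇒≯ k≤i)
∈-indexedFrom⁺ {i} k (a ∷ la) k≤i i<k+ℓ with i ≟ k
... | yes refl = a , here refl
... | no i≢k with ∈-indexedFrom⁺ (suc k) la (≤∧≢⇒< k≤i (i≢k ∘ sym)) (subst (i <_) (+-suc k (length la)) i<k+ℓ)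
...   | b , p∈ = b , there p∈

∈-indexedFrom-map⁺ : ∀ {i a} (f : ℕ → ℕ) k la → (i , a) ∈ indexedFrom k la → (i , f a) ∈ indexedFrom k (map f la)
∈-indexedFrom-map⁺ f k (a ∷ la) (here refl) = here refl
∈-indexedFrom-map⁺ f k (b ∷ la) (there p∈)  = there (∈-indexedFrom-map⁺ f (suc k) la p∈)

∈-indexedFrom-map⁻ : ∀ {i b} (f : ℕ → ℕ) k la → (i , b) ∈ indexedFrom k (map f la) →
                     ∃[ a ] (i , a) ∈ indexedFrom k la × b ≡ f a
∈-indexedFrom-map⁻ f k (a ∷ la) (here refl) = a , here refl , refl
∈-indexedFrom-map⁻ f k (a ∷ la) (there p∈) with ∈-indexedFrom-map⁻ f (suc k) la p∈
... | a′ , p′∈ , b≡fa′ = a′ , there p′∈ , b≡fa′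

map-proj₂-filter-indexedFrom : ∀ {p} {P : Pred ℕ p} (P? : Decidable P) k la →
                               map proj₂ (filter (P? ∘ proj₂) (indexedFrom k la)) ≡ filter P? la
map-proj₂-filter-indexedFrom P? k []       = refl
map-proj₂-filter-indexedFrom P? k (a ∷ la) with P? a
... | yes _ = cong (a ∷_) (map-proj₂-filter-indexedFrom P? (suc k) la)
... | no _  = map-proj₂-filter-indexedFrom P? (suc k) la

∈-diagramFrom⁻ : ∀ {i j} k la → (i , j) ∈ diagramFrom k la → ∃[ a ] (i , a) ∈ indexedFrom k la × 1 ≤ j × j ≤ a
∈-diagramFrom⁻ k la z∈ with find (∈-concatMap⁻ rowCells {xs = indexedFrom k la} z∈)
... | (i , a) , p∈ , z∈row with ∈-map⁻ (λ j → (i , suc j)) z∈row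
...   | j , j∈ , refl = a , p∈ , s≤s z≤n , ∈-upTo⁻ j∈

∈-diagramFrom⁺ : ∀ {i a j} k la → (i , a) ∈ indexedFrom k la → j < a → (i , suc j) ∈ diagramFrom k la
∈-diagramFrom⁺ {i} k la p∈ j<a =
  ∈-concatMap⁺ rowCells {xs = indexedFrom k la} (lose p∈ (∈-map⁺ (λ j → (i , suc j)) (∈-upTo⁺ j<a)))

-- firstPart [] = 0 plays the role of λ_{ℓ+1} = 0.
firstPart : List ℕ → ℕ
firstPart []      = 0
firstPart (a ∷ _) = a

firstPart-linked : ∀ {r} {R : ℕ → ℕ → Set r} {a rest} → R a 0 → Linked R (a ∷ rest) → R a (firstPart rest)
firstPart-linked Ra0 [-]       = Ra0
firstPart-linked _   (Rab ∷ _) = Rab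

≤-firstPart : ∀ {a la} → Linked _≥_ la → a ∈ la → a ≤ firstPart la
≤-firstPart _                  (here refl) = ≤-refl
≤-firstPart (b≤a ∷ decreasing) (there a∈)  = ≤-trans (≤-firstPart decreasing a∈) b≤a

rows-rowCells : ∀ p → All (λ z → proj₁ z ≡ proj₁ p) (rowCells p)
rows-rowCells p = All.tabulate λ z∈ → case ∈-map⁻ _ z∈ of λ { (_ , _ , refl) → refl }

rows-diagramFrom : ∀ k la → All (λ z → k ≤ proj₁ z) (diagramFrom k la)
rows-diagramFrom k la = All.tabulate λ {(i , j)} z∈ →
  case ∈-diagramFrom⁻ k la z∈ of λ { (_ , p∈ , _) → proj₁ (∈-indexedFrom⁻ k la p∈) }

cols-diagramFrom : ∀ k la → Linked _≥_ la → All (λ z → proj₂ z ≤ firstPart la) (diagramFrom k la)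
cols-diagramFrom k la decreasing = All.tabulate λ {(i , j)} z∈ →
  case ∈-diagramFrom⁻ k la z∈ of λ { (_ , p∈ , _ , j≤a) →
    ≤-trans j≤a (≤-firstPart decreasing (proj₂ (proj₂ (∈-indexedFrom⁻ k la p∈)))) }

module _ (s : ℕ) {{_ : NonZero s}} where

  ∈-greenCells⁻ : ∀ {z} la → z ∈ greenCells s la →
                  ∃₂ λ i a → (i , a) ∈ indexedFrom 1 la × ¬ s ∣ a × z ≡ (i , ceilDiv a s)
  ∈-greenCells⁻ la z∈ with ∈-map⁻ _ z∈
  ... | (i , a) , p∈ , refl with ∈-filter⁻ (λ p → ¬? (s ∣? proj₂ p)) p∈
  ...   | p∈indexed , s∤a = i , a , subst ((i , a) ∈_) (indexed≡indexedFrom la) p∈indexed , s∤a , refl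

  ∈-greenCells⁺ : ∀ {i a} la → (i , a) ∈ indexedFrom 1 la → ¬ s ∣ a → (i , ceilDiv a s) ∈ greenCells s la
  ∈-greenCells⁺ la p∈ s∤a = ∈-map⁺ (λ p → (proj₁ p , ceilDiv (proj₂ p) s))
    (∈-filter⁺ (λ p → ¬? (s ∣? proj₂ p)) (subst (_ ∈_) (sym (indexed≡indexedFrom la)) p∈) s∤a)

  ∈-diagram-downS⁻ : ∀ {i j} la → (i , j) ∈ diagram (downS s la) →
                     ∃[ a ] (i , a) ∈ indexedFrom 1 la × 1 ≤ j × j ≤ a / s
  ∈-diagram-downS⁻ la z∈
    with ∈-diagramFrom⁻ 1 (downS s la) (subst (_ ∈_) (diagram≡diagramFrom (downS s la)) z∈)
  ... | _ , p∈ , 1≤j , j≤a/s with ∈-indexedFrom-map⁻ (_/ s) 1 la p∈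
  ...   | a , p′∈ , refl = a , p′∈ , 1≤j , j≤a/s

  ∈-diagram-downS⁺ : ∀ {i a j} la → (i , a) ∈ indexedFrom 1 la → j < a / s → (i , suc j) ∈ diagram (downS s la)
  ∈-diagram-downS⁺ la p∈ j<a/s = subst (_ ∈_) (sym (diagram≡diagramFrom (downS s la)))
    (∈-diagramFrom⁺ 1 (downS s la) (∈-indexedFrom-map⁺ (_/ s) 1 la p∈) j<a/s)

  rows-nuPlus⇔ : ∀ {x} la → All (0 <_) la → x ∈ map proj₁ (nuPlus s la) ⇔ (1 ≤ x × x ≤ length la)
  rows-nuPlus⇔ {x} la positive = mk⇔ to from
    where
    row-bounds : ∀ {i a} → (i , a) ∈ indexedFrom 1 la → 1 ≤ i × i ≤ length la
    row-bounds p∈ with ∈-indexedFrom⁻ 1 la p∈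
    ... | 1≤i , i<1+ℓ , _ = 1≤i , s≤s⁻¹ i<1+ℓ
    to : x ∈ map proj₁ (nuPlus s la) → 1 ≤ x × x ≤ length la
    to x∈ with ∈-map⁻ proj₁ x∈
    ... | z , z∈ , refl with ∈-++⁻ (diagram (downS s la)) z∈
    ...   | inj₁ z∈ν with ∈-diagram-downS⁻ la z∈ν
    ...     | _ , p∈ , _ = row-bounds p∈
    to x∈ | z , z∈ , refl | inj₂ z∈green with ∈-greenCells⁻ la z∈green
    ...     | _ , _ , p∈ , _ , refl = row-bounds p∈
    from : 1 ≤ x × x ≤ length la → x ∈ map proj₁ (nuPlus s la)
    from (1≤x , x≤ℓ) with ∈-indexedFrom⁺ 1 la 1≤x (s≤s x≤ℓ)
    ... | a , p∈ with s ∣? a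
    ...   | yes s∣a = ∈-map⁺ proj₁ (∈-++⁺ˡ (∈-diagram-downS⁺ la p∈ (m≥n⇒m/n>0 (∣⇒≤ {{>-nonZero a>0}} s∣a))))
      where a>0 = All.lookup positive (proj₂ (proj₂ (∈-indexedFrom⁻ 1 la p∈)))
    ...   | no s∤a  = ∈-map⁺ proj₁ (∈-++⁺ʳ (diagram (downS s la)) (∈-greenCells⁺ la p∈ s∤a))

  cols-nuPlus⇔ : ∀ {x} la → IsPartition la → x ∈ map proj₂ (nuPlus s la) ⇔ (1 ≤ x × x ≤ ceilDiv (firstPart la) s)
  cols-nuPlus⇔ {x} la (decreasing , positive) = mk⇔ to (from la)
    where
    part-bounds : ∀ {i a} → (i , a) ∈ indexedFrom 1 la → 0 < a × a ≤ firstPart la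
    part-bounds p∈ with a∈ ← proj₂ (proj₂ (∈-indexedFrom⁻ 1 la p∈)) =
      All.lookup positive a∈ , ≤-firstPart decreasing a∈
    to : x ∈ map proj₂ (nuPlus s la) → 1 ≤ x × x ≤ ceilDiv (firstPart la) s
    to x∈ with ∈-map⁻ proj₂ x∈
    ... | z , z∈ , refl with ∈-++⁻ (diagram (downS s la)) z∈
    ...   | inj₁ z∈ν with ∈-diagram-downS⁻ la z∈ν
    ...     | a , p∈ , 1≤j , j≤a/s =
              1≤j , ≤-trans j≤a/s (≤-trans (/≤ceilDiv a s) (ceilDiv-mono-≤ s (proj₂ (part-bounds p∈))))
    to x∈ | z , z∈ , refl | inj₂ z∈green with ∈-greenCells⁻ la z∈green
    ...     | _ , a , p∈ , _ , refl =
              ceilDiv-pos s (proj₁ (part-bounds p∈)) , ceilDiv-mono-≤ s (proj₂ (part-bounds p∈))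
    from : ∀ la → 1 ≤ x × x ≤ ceilDiv (firstPart la) s → x ∈ map proj₂ (nuPlus s la)
    from [] (1≤x , x≤⌈0/s⌉) =
      contradiction (≤-trans 1≤x (≤-trans x≤⌈0/s⌉ (≤-reflexive (trans (ceilDiv-∣ s (s ∣0)) (0/n≡0 s))))) λ ()
    from (a ∷ rest) (s≤s {n = j} z≤n , 1+j≤⌈a/s⌉) with j <? a / s
    ... | yes j<a/s = ∈-map⁺ proj₂ (∈-++⁺ˡ (∈-diagram-downS⁺ (a ∷ rest) (here refl) j<a/s))
    ... | no j≮a/s  = subst (_∈ map proj₂ (nuPlus s (a ∷ rest))) (sym 1+j≡⌈a/s⌉)
            (∈-map⁺ proj₂ (∈-++⁺ʳ (diagram (downS s (a ∷ rest))) (∈-greenCells⁺ (a ∷ rest) (here refl) s∤a)))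
      where
      s∤a : ¬ s ∣ a
      s∤a s∣a = j≮a/s (≤-trans 1+j≤⌈a/s⌉ (≤-reflexive (ceilDiv-∣ s s∣a)))
      1+j≡⌈a/s⌉ : suc j ≡ ceilDiv a s
      1+j≡⌈a/s⌉ = trans (cong suc (≤-antisym j≤a/s (≮⇒≥ j≮a/s))) (sym (ceilDiv-∤ s s∤a))
        where j≤a/s = s≤s⁻¹ (subst (suc j ≤_) (ceilDiv-∤ s s∤a) 1+j≤⌈a/s⌉)

-- The statistic c_s

-- leg la and arm la are legIn (diagram la) and armIn (diagram la) by definition, and
-- c s la is cCount s (diagram la) (diagram la).
legIn : List Cell → Cell → ℕ
legIn cs z = length (filter (λ c → (proj₁ z <? proj₁ c) ×-dec (proj₂ c ≟ proj₂ z)) cs)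

armIn : List Cell → Cell → ℕ
armIn cs z = length (filter (λ c → (proj₁ c ≟ proj₁ z) ×-dec (proj₂ z <? proj₂ c)) cs)

cCount : ℕ → List Cell → List Cell → ℕ
cCount s cs zs = length (filter (λ z → (legIn cs z ≟ 0) ×-dec (s ∣? suc (armIn cs z))) zs)

legIn-above : ∀ {z} cs → All (λ c → proj₁ c ≤ proj₁ z) cs → legIn cs z ≡ 0
legIn-above cs above = cong length (filter-none _ (All.map (λ c≤z (z<c , _) → <⇒≱ z<c c≤z) above))

legIn-left : ∀ {z} cs → All (λ c → proj₂ c < proj₂ z) cs → legIn cs z ≡ 0
legIn-left cs left = cong length (filter-none _ (All.map (λ c<z (_ , c≡z) → <-irrefl c≡z c<z) left))

armIn-otherRows : ∀ {z} cs → All (λ c → proj₁ c ≢ proj₁ z) cs → armIn cs z ≡ 0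
armIn-otherRows cs otherRows = cong length (filter-none _ (All.map (λ c≢z (c≡z , _) → c≢z c≡z) otherRows))

armIn-topRow : ∀ {k a j} rest → j < a → suc (armIn (diagramFrom k (a ∷ rest)) (k , suc j)) ≡ a ∸ j
armIn-topRow {k} {a} {j} rest j<a = begin
  suc (armIn (X ++ Y) (k , suc j))                            ≡⟨ cong suc (length-filter-++ _ X Y) ⟩
  suc (armIn X (k , suc j) + armIn Y (k , suc j))
    ≡⟨ cong (λ n → suc (armIn X (k , suc j) + n)) (armIn-otherRows Y lower) ⟩
  suc (armIn X (k , suc j) + 0)                               ≡⟨ cong suc (+-identityʳ _) ⟩
  suc (armIn X (k , suc j))                                   ≡⟨ cong suc (length-filter-map _ (λ t → (k , suc t)) (upTo a)) ⟩
  suc (length (filter (λ t → (k ≟ k) ×-dec (suc j <? suc t)) (upTo a)))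
    ≡⟨ cong (suc ∘ length) (filter-≐ _ (j <?_) (s≤s⁻¹ ∘ proj₂ , λ j<t → refl , s≤s j<t) (upTo a)) ⟩
  suc (length (filter (j <?_) (upTo a)))                      ≡⟨ cong suc (count-< j a) ⟩
  suc (a ∸ suc j)                                             ≡⟨ +-∸-assoc 1 j<a ⟨
  a ∸ j                                                       ∎
  where
  X = rowCells (k , a)
  Y = diagramFrom (suc k) rest
  lower : All (λ c → proj₁ c ≢ k) Y
  lower = All.map (λ k<i i≡k → <-irrefl (sym i≡k) k<i) (rows-diagramFrom (suc k) rest)

legIn-topRow⇔ : ∀ {k a j} rest → Linked _≥_ (a ∷ rest) →
                legIn (diagramFrom k (a ∷ rest)) (k , suc j) ≡ 0 ⇔ firstPart rest ≤ j
legIn-topRow⇔ {k} {a} {j} rest decreasing = mk⇔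
  (λ leg≡0 → ≮⇒≥ λ j<b → <-irrefl (sym (trans (sym leg≡legY) leg≡0)) (cell-below rest j<b))
  (λ b≤j → trans leg≡legY (legIn-left Y
     (All.map (λ c≤b → s≤s (≤-trans c≤b b≤j)) (cols-diagramFrom (suc k) rest (Linked.tail decreasing)))))
  where
  X = rowCells (k , a)
  Y = diagramFrom (suc k) rest
  leg≡legY : legIn (X ++ Y) (k , suc j) ≡ legIn Y (k , suc j)
  leg≡legY = trans (length-filter-++ _ X Y) (cong (_+ _) (legIn-above X (All.map ≤-reflexive (rows-rowCells (k , a)))))
  cell-below : ∀ rest → j < firstPart rest → 0 < legIn (diagramFrom (suc k) rest) (k , suc j)
  cell-below (b ∷ rest) j<b =
    length-filter-pos _ (∈-diagramFrom⁺ (suc k) (b ∷ rest) (here refl) j<b) (n<1+n k , refl)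

module _ (s : ℕ) {{_ : NonZero s}} where

  gapQuotientSum : List ℕ → ℕ
  gapQuotientSum []         = 0
  gapQuotientSum (a ∷ rest) = (a ∸ firstPart rest) / s + gapQuotientSum rest

  cCount-cong : ∀ {cs cs′} zs → All (λ z → legIn cs z ≡ legIn cs′ z × armIn cs z ≡ armIn cs′ z) zs →
                cCount s cs zs ≡ cCount s cs′ zs
  cCount-cong zs same = cong length (filter-cong-All _ _ (All.map (λ (leg≡ , arm≡) → mk⇔
    (map₁ (trans (sym leg≡)) ∘ map₂ (subst (λ n → s ∣ suc n) arm≡))
    (map₁ (trans leg≡) ∘ map₂ (subst (λ n → s ∣ suc n) (sym arm≡)))) same))

  cCount-lowerRows : ∀ k a rest → cCount s (diagramFrom k (a ∷ rest)) (diagramFrom (suc k) rest)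
                                ≡ cCount s (diagramFrom (suc k) rest) (diagramFrom (suc k) rest)
  cCount-lowerRows k a rest = cCount-cong {X ++ Y} {Y} Y (All.map unaffected (rows-diagramFrom (suc k) rest))
    where
    X = rowCells (k , a)
    Y = diagramFrom (suc k) rest
    unaffected : ∀ {z} → suc k ≤ proj₁ z → legIn (X ++ Y) z ≡ legIn Y z × armIn (X ++ Y) z ≡ armIn Y z
    unaffected k<z =
      trans (length-filter-++ _ X Y) (cong (_+ _) (legIn-above X
        (All.map (λ c≡k → <⇒≤ (subst (_< _) (sym c≡k) k<z)) (rows-rowCells (k , a))))) ,
      trans (length-filter-++ _ X Y) (cong (_+ _) (armIn-otherRows X
        (All.map (λ c≡k c≡z → <-irrefl (trans (sym c≡k) c≡z) k<z) (rows-rowCells (k , a)))))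

  cCount-topRow : ∀ k a rest → Linked _≥_ (a ∷ rest) →
                  cCount s (diagramFrom k (a ∷ rest)) (rowCells (k , a)) ≡ (a ∸ firstPart rest) / s
  cCount-topRow k a rest decreasing = begin
    cCount s D (rowCells (k , a))
      ≡⟨ length-filter-map _ (λ j → (k , suc j)) (upTo a) ⟩
    length (filter (λ j → (legIn D (k , suc j) ≟ 0) ×-dec (s ∣? suc (armIn D (k , suc j)))) (upTo a))
      ≡⟨ cong length (filter-cong-All _ _ (All.tabulate (c-cell⇔ ∘ ∈-upTo⁻))) ⟩
    length (filter (λ j → (b ≤? j) ×-dec (s ∣? (a ∸ j))) (upTo a))
      ≡⟨ count-gap-multiples s b a ⟩
    (a ∸ b) / s ∎
    where
    D = diagramFrom k (a ∷ rest)
    b = firstPart rest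
    c-cell⇔ : ∀ {j} → j < a → (legIn D (k , suc j) ≡ 0 × s ∣ suc (armIn D (k , suc j))) ⇔ (b ≤ j × s ∣ a ∸ j)
    c-cell⇔ j<a = mk⇔
      (map₁ (Equivalence.to (legIn-topRow⇔ rest decreasing)) ∘ map₂ (subst (s ∣_) (armIn-topRow rest j<a)))
      (map₁ (Equivalence.from (legIn-topRow⇔ rest decreasing)) ∘ map₂ (subst (s ∣_) (sym (armIn-topRow rest j<a))))

  cCount-diagramFrom : ∀ k la → Linked _≥_ la → cCount s (diagramFrom k la) (diagramFrom k la) ≡ gapQuotientSum la
  cCount-diagramFrom k []         _          = refl
  cCount-diagramFrom k (a ∷ rest) decreasing = begin
    cCount s D (rowCells (k , a) ++ diagramFrom (suc k) rest)
      ≡⟨ length-filter-++ _ (rowCells (k , a)) (diagramFrom (suc k) rest) ⟩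
    cCount s D (rowCells (k , a)) + cCount s D (diagramFrom (suc k) rest)
      ≡⟨ cong₂ _+_ (cCount-topRow k a rest decreasing) (cCount-lowerRows k a rest) ⟩
    (a ∸ firstPart rest) / s + cCount s (diagramFrom (suc k) rest) (diagramFrom (suc k) rest)
      ≡⟨ cong ((a ∸ firstPart rest) / s +_) (cCount-diagramFrom (suc k) rest (Linked.tail decreasing)) ⟩
    gapQuotientSum (a ∷ rest) ∎
    where
    D = diagramFrom k (a ∷ rest)

  c≡gapQuotientSum : ∀ la → Linked _≥_ la → c s la ≡ gapQuotientSum la
  c≡gapQuotientSum la decreasing =
    trans (cong (λ cs → cCount s cs cs) (diagram≡diagramFrom la)) (cCount-diagramFrom 1 la decreasing)

-- Telescoping

module _ (s : ℕ) where

  nonMultiples : List ℕ → List ℕ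
  nonMultiples = filter (λ a → ¬? (s ∣? a))

  length-rowPositions : ∀ la → length (rowPositions s la) ≡ length (nonMultiples la)
  length-rowPositions la = begin
    length (map proj₁ (filter (λ p → ¬? (s ∣? proj₂ p)) (indexed la)))
      ≡⟨ length-map proj₁ (filter (λ p → ¬? (s ∣? proj₂ p)) (indexed la)) ⟩
    length (filter (λ p → ¬? (s ∣? proj₂ p)) (indexed la))
      ≡⟨ cong (λ ps → length (filter (λ p → ¬? (s ∣? proj₂ p)) ps)) (indexed≡indexedFrom la) ⟩
    length (filter (λ p → ¬? (s ∣? proj₂ p)) (indexedFrom 1 la))
      ≡⟨ length-map proj₂ (filter (λ p → ¬? (s ∣? proj₂ p)) (indexedFrom 1 la)) ⟨
    length (map proj₂ (filter (λ p → ¬? (s ∣? proj₂ p)) (indexedFrom 1 la)))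
      ≡⟨ cong length (map-proj₂-filter-indexedFrom (λ a → ¬? (s ∣? a)) 1 la) ⟩
    length (nonMultiples la) ∎

module _ (s : ℕ) {{_ : NonZero s}} where

  remainders≡ : ∀ la → remainders s la ≡ map (_% s) (nonMultiples s la)
  remainders≡ la = begin
    map (λ p → proj₂ p % s) (filter (λ p → ¬? (s ∣? proj₂ p)) (indexed la))
      ≡⟨ cong (λ ps → map (λ p → proj₂ p % s) (filter (λ p → ¬? (s ∣? proj₂ p)) ps)) (indexed≡indexedFrom la) ⟩
    map (λ p → proj₂ p % s) (filter (λ p → ¬? (s ∣? proj₂ p)) (indexedFrom 1 la))
      ≡⟨ map-∘ (filter (λ p → ¬? (s ∣? proj₂ p)) (indexedFrom 1 la)) ⟩
    map (_% s) (map proj₂ (filter (λ p → ¬? (s ∣? proj₂ p)) (indexedFrom 1 la)))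
      ≡⟨ cong (map (_% s)) (map-proj₂-filter-indexedFrom (λ a → ¬? (s ∣? a)) 1 la) ⟩
    map (_% s) (nonMultiples s la) ∎

  adjacent-remainders : ∀ la → Linked (λ a b → a % s < b % s) (nonMultiples s la) →
                        Linked (λ a b → s ∣ b ⊎ a % s < b % s) la
  adjacent-remainders []             _          = []
  adjacent-remainders (a ∷ [])       _          = [-]
  adjacent-remainders (a ∷ b ∷ rest) increasing =
    adjacent (s ∣? b) (s ∣? a) increasing ∷ adjacent-remainders (b ∷ rest) (linked-filter-tail ∤? increasing)
    where
    ∤? = λ a → ¬? (s ∣? a)
    adjacent : Dec (s ∣ b) → Dec (s ∣ a) → Linked (λ a b → a % s < b % s) (nonMultiples s (a ∷ b ∷ rest)) →
               s ∣ b ⊎ a % s < b % s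
    adjacent (yes s∣b) _         _          = inj₁ s∣b
    adjacent (no s∤b)  (yes s∣a) _          =
      inj₂ (subst (_< b % s) (sym (n∣m⇒m%n≡0 a s s∣a)) (n≢0⇒n>0 (s∤b ∘ m%n≡0⇒n∣m b s)))
    adjacent (no s∤b)  (no s∤a)  increasing = inj₂ (Linked.head
      (subst (Linked _) (trans (filter-accept ∤? s∤a) (cong (a ∷_) (filter-accept ∤? s∤b))) increasing))

  ceilDiv≡/+nonMultiple : ∀ a → ceilDiv a s ≡ a / s + length (nonMultiples s (a ∷ []))
  ceilDiv≡/+nonMultiple a with s ∣? a
  ... | yes s∣a = trans (ceilDiv-∣ s s∣a) (sym (+-identityʳ (a / s)))
  ... | no s∤a  = trans (ceilDiv-∤ s s∤a) (+-comm 1 (a / s))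

  gapQuotientSum+nonMultiples≡ceilDiv : ∀ la → Linked _≥_ la → Linked (λ a b → s ∣ b ⊎ a % s < b % s) la →
    gapQuotientSum s la + length (nonMultiples s la) ≡ ceilDiv (firstPart la) s
  gapQuotientSum+nonMultiples≡ceilDiv [] _ _ = sym (trans (ceilDiv-∣ s (s ∣0)) (0/n≡0 s))
  gapQuotientSum+nonMultiples≡ceilDiv (a ∷ rest) decreasing adjacent = begin
    (a ∸ b) / s + G + length (nonMultiples s (a ∷ rest))
      ≡⟨ cong ((a ∸ b) / s + G +_) (length-filter-++ _ (a ∷ []) rest) ⟩
    (a ∸ b) / s + G + (n₁ + N)
      ≡⟨ solve 4 (λ x g n₁ n → x :+ g :+ (n₁ :+ n) := x :+ (g :+ n) :+ n₁) refl ((a ∸ b) / s) G n₁ N ⟩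
    (a ∸ b) / s + (G + N) + n₁
      ≡⟨ cong (λ x → (a ∸ b) / s + x + n₁) IH ⟩
    (a ∸ b) / s + ceilDiv b s + n₁
      ≡⟨ cong (_+ n₁) ([a∸b]/s+⌈b/s⌉≡a/s s b≤a step) ⟩
    a / s + n₁
      ≡⟨ ceilDiv≡/+nonMultiple a ⟨
    ceilDiv a s ∎
    where
    open +-*-Solver
    b = firstPart rest
    G = gapQuotientSum s rest
    N = length (nonMultiples s rest)
    n₁ = length (nonMultiples s (a ∷ []))
    b≤a = firstPart-linked z≤n decreasing
    step = firstPart-linked (inj₁ (s ∣0)) adjacent
    IH = gapQuotientSum+nonMultiples≡ceilDiv rest (Linked.tail decreasing) (Linked.tail adjacent)

lemma3p5 : (s : ℕ) → {{_ : NonZero s}} → (la : List ℕ) → IsPartition la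
    → Linked _<_ (remainders s la)
    → (r s la + length (rowPositions s la) ≡ numRows (nuPlus s la))
      × (c s la + length (rowPositions s la) ≡ numCols (nuPlus s la))
lemma3p5 s la (decreasing , positive) increasing =
  (begin
    r s la + length (rowPositions s la)     ≡⟨ cong (r s la +_) (length-rowPositions s la) ⟩
    r s la + length (nonMultiples s la)     ≡⟨ length-filter-+-∁ (s ∣?_) la ⟩
    length la                               ≡⟨ length-deduplicate-interval (length la) (rows-nuPlus⇔ s la positive) ⟨
    numRows (nuPlus s la)                   ∎) ,
  (begin
    c s la + length (rowPositions s la)     ≡⟨ cong₂ _+_ (c≡gapQuotientSum s la decreasing) (length-rowPositions s la) ⟩
    gapQuotientSum s la + length (nonMultiples s la)
      ≡⟨ gapQuotientSum+nonMultiples≡ceilDiv s la decreasing (adjacent-remainders s la remaindersIncreasing) ⟩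
    ceilDiv (firstPart la) s                ≡⟨ length-deduplicate-interval _ (cols-nuPlus⇔ s la (decreasing , positive)) ⟨
    numCols (nuPlus s la)                   ∎)
  where
  remaindersIncreasing : Linked (λ a b → a % s < b % s) (nonMultiples s la)
  remaindersIncreasing = Linked.map⁻ (subst (Linked _<_) (remainders≡ s la) increasing)
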